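{- Let $\Phi(x_1,x_2) = u_1x_1+u_2x_2$ be a binary linear form with relatively prime positive integer coefficients $u_1 < u_2$. Then there exists a set $A$ of integers such that $R_{A,\Phi}(n) = 1$ for all integers $n$.
   Context: For a set $A$ of integers and an integer $n$, $R_{A,\Phi}(n) = \operatorname{card}\{(a_1,a_2) \in A\times A : u_1a_1+u_2a_2 = n\}$ (ordered pairs). A set $A$ with $R_{A,\Phi}(n)=1$ for every integer $n$ is called a unique representation basis with respect to $\Phi$. -}

module Defs where

open import Level using (0ℓ)
open import Data.Nat using (ℕ)
open import Data.Integer using (ℤ; +_; _+_; _*_)
open import Data.Product using (Σ; _×_; _,_)
open import Relation.Binary.PropositionalEquality using (_≡_)
open import Relation.Unary using (Pred)

SetOfIntegers : Set₁
SetOfIntegers = Pred ℤ 0ℓ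

Φ : ℤ → ℤ → ℤ → ℤ → ℤ
Φ u₁ u₂ x₁ x₂ = u₁ * x₁ + u₂ * x₂

RepresentationCountOne : SetOfIntegers → ℤ → ℤ → ℤ → Set
RepresentationCountOne A u₁ u₂ n =
  Σ (ℤ × ℤ) (λ { (a₁ , a₂) → A a₁ × A a₂ × Φ u₁ u₂ a₁ a₂ ≡ n
     × (∀ b₁ b₂ → A b₁ → A b₂ → Φ u₁ u₂ b₁ b₂ ≡ n → (b₁ , b₂) ≡ (a₁ , a₂)) })

UniqueRepresentationBasis : SetOfIntegers → ℤ → ℤ → Set
UniqueRepresentationBasis A u₁ u₂ = ∀ (n : ℤ) → RepresentationCountOne A u₁ u₂ n

module Submission where

-- Construction: expansions in the negative base −N, N = u₂².
--
-- Write u₂ = w + 1 and m = ⌊w/2⌋.  A digit d ∈ Fin u₂ stands for ⟦d⟧ = d − m, so the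
-- digit values are the consecutive integers −m, …, w − m.  A is the set of integers
-- Σ ⟦dᵢ⟧(−N)ⁱ (finitely many digits).  By linearity of Φ, u₁a + u₂b = Σ cᵢ(−N)ⁱ with the
-- combined digits cᵢ = u₁⟦dᵢ⟧ + u₂⟦eᵢ⟧, and these
--  (i)  are pairwise incongruent mod N (as u₁ ⊥ u₂), hence by counting a complete
--       residue system mod N;
--  (ii) lie in [−K, N − 1] with K = (u₁ + u₂)m ≤ N − 2.
-- Existence: by (i) write n = c + (−N)t with c a combined digit; by (ii) t precedes n in
-- the order 0, 1, −1, 2, −2, …, so peeling digits terminates.  Uniqueness: by (i) two
-- representations of n have the same lowest digits; cancel them and recurse.

open import Defs
open import Data.Nat using (ℕ; _<_; _≤_)
open import Data.Nat.Coprimality using (Coprime)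
open import Data.Integer using (+_)
open import Data.Product using (Σ)

open import Function using (_∘_; _on_)
open import Data.Nat as ℕ using (zero; suc; z≤n; s≤s)
import Data.Nat.Properties as ℕP
import Data.Nat.Divisibility as ℕD
import Data.Nat.DivMod as ℕDM
import Data.Nat.Coprimality as Coprimality
open import Data.Nat.Induction using (<-wellFounded)
open import Data.Integer as ℤ using (ℤ; -[1+_]; 0ℤ; _+_; _*_; _-_; -_; _⊖_)
import Data.Integer.Properties as ℤP
open import Data.Integer.DivMod using (_/ℕ_; _%ℕ_; a≡a%ℕn+[a/ℕn]*n; n%ℕd<d)
open import Data.Integer.Divisibility.Signed as ℤD using (_∣_; divides)
open import Data.Integer.Tactic.RingSolver using (solve-∀)
import Data.Nat.Tactic.RingSolver as ℕSolver
open import Data.Fin as Fin using (Fin; toℕ; fromℕ<)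
import Data.Fin.Properties as FinP
open import Data.List using (List; []; _∷_; length)
open import Data.Product using (_×_; _,_; proj₁; proj₂; ∃; ∃₂; uncurry)
open import Data.Sum using (_⊎_; inj₁; inj₂)
open import Data.Empty using (⊥-elim)
open import Relation.Nullary using (yes; no)
open import Relation.Binary.PropositionalEquality
open import Induction.WellFounded using (Acc; acc)
import Relation.Binary.Construct.On as On

-- An injective endomap of a finite set is surjective (pigeonhole principle).  It turns
-- "pairwise incongruent" into "a complete residue system".
injective⇒surjective : ∀ {n} (f : Fin n → Fin n) → (∀ i j → f i ≡ f j → i ≡ j) →
                       ∀ r → ∃ λ i → f i ≡ r
injective⇒surjective {suc n} f inj r with FinP.any? (λ i → f i Fin.≟ r)
... | yes hit = hit
... | no miss =
  let (i , j , i<j , same) = FinP.pigeonhole (ℕP.n<1+n n) (λ k → Fin.punchOut (avoids k))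
  in ⊥-elim (FinP.<⇒≢ i<j (inj i j (FinP.punchOut-injective (avoids i) (avoids j) same)))
  where
  avoids : ∀ k → r ≢ f k
  avoids k eq = miss (k , sym eq)

Φ-linear : ∀ u₁ u₂ x y x′ y′ β → Φ u₁ u₂ (x + β * x′) (y + β * y′) ≡ Φ u₁ u₂ x y + β * Φ u₁ u₂ x′ y′
Φ-linear = expand
  where
  expand : ∀ a b x y x′ y′ β → a * (x + β * x′) + b * (y + β * y′) ≡ (a * x + b * y) + β * (a * x′ + b * y′)
  expand = solve-∀

+-cancelˡ : ∀ a x y → a + x ≡ a + y → x ≡ y
+-cancelˡ a x y eq = begin
  x            ≡⟨ restore a x ⟩
  (a + x) - a  ≡⟨ cong (_- a) eq ⟩
  (a + y) - a  ≡⟨ restore a y ⟨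
  y            ∎
  where
  open ≡-Reasoning
  restore : ∀ a x → x ≡ (a + x) - a
  restore = solve-∀

≤-by : ∀ {a b} c → a ℕ.+ c ≡ b → a ≤ b
≤-by {a} c eq = subst (a ≤_) eq (ℕP.m≤m+n a c)

nonZero : ∀ {K N} → suc K < N → ℕ.NonZero N
nonZero K<N = ℕ.>-nonZero (ℕP.<-≤-trans (s≤s z≤n) (ℕP.<⇒≤ K<N))

pos neg : ℤ → ℕ
pos (+ k)    = k
pos -[1+ _ ] = 0
neg (+ _)    = 0
neg -[1+ k ] = suc k

pos-neg : ∀ i → i ≡ + pos i - + neg i
pos-neg (+ k)    = cong +_ (sym (ℕP.+-identityʳ k))
pos-neg -[1+ k ] = refl

-- A size ordering ℤ as 0, 1, −1, 2, −2, …; digit peeling decreases it.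
size : ℤ → ℕ
size (+ k)    = k ℕ.+ k
size -[1+ k ] = suc (suc k ℕ.+ suc k)

equation-in-ℕ : ∀ X K N p q p′ q′ → + X - + K ≡ (+ p - + q) + + N * (+ p′ - + q′) →
                q′ ℕ.* N ℕ.+ q ℕ.+ X ≡ p′ ℕ.* N ℕ.+ p ℕ.+ K
equation-in-ℕ X K N p q p′ q′ eq = ℤP.+-injective (begin
  + (q′ ℕ.* N ℕ.+ q ℕ.+ X)                                      ≡⟨ lift q′ N q X ⟩
  + q′ * + N + + q + + X                                        ≡⟨ move (+ X) (+ K) (+ q) (+ q′) (+ N) ⟩
  (+ X - + K) + (+ q′ * + N + + q + + K)                        ≡⟨ cong (_+ (+ q′ * + N + + q + + K)) eq ⟩
  ((+ p - + q) + + N * (+ p′ - + q′)) + (+ q′ * + N + + q + + K) ≡⟨ cancel (+ p) (+ q) (+ p′) (+ q′) (+ N) (+ K) ⟩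
  + p′ * + N + + p + + K                                        ≡⟨ lift p′ N p K ⟨
  + (p′ ℕ.* N ℕ.+ p ℕ.+ K)                                      ∎)
  where
  open ≡-Reasoning
  lift : ∀ a b c d → + (a ℕ.* b ℕ.+ c ℕ.+ d) ≡ + a * + b + + c + + d
  lift a b c d = trans (ℤP.pos-+ (a ℕ.* b ℕ.+ c) d)
    (cong (_+ + d) (trans (ℤP.pos-+ (a ℕ.* b) c) (cong (_+ + c) (ℤP.pos-* a b))))
  move : ∀ x k q q′ n → q′ * n + q + x ≡ (x - k) + (q′ * n + q + k)
  move = solve-∀
  cancel : ∀ p q p′ q′ n k → ((p - q) + n * (p′ - q′)) + (q′ * n + q + k) ≡ p′ * n + p + k
  cancel = solve-∀

-- The digit X − K lies in [−K, N − 1]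
-- and K ≤ N − 2: n, t > 0 would need a digit ≥ N, n, t < 0 a digit < −N, and in the
-- mixed cases |t| is small compared with |n|.
decrease : ∀ {X K N} (n t : ℤ) → X < N ℕ.+ K → suc K < N → n ≢ 0ℤ →
           neg t ℕ.* N ℕ.+ neg n ℕ.+ X ≡ pos t ℕ.* N ℕ.+ pos n ℕ.+ K → size t < size n
decrease (+ zero)  _        _ _ n≢0 _ = ⊥-elim (n≢0 refl)
decrease (+ suc _) (+ zero) _ _ _   _ = s≤s z≤n
decrease -[1+ _ ]  (+ zero) _ _ _   _ = s≤s z≤n
decrease {K = K} {N} (+ k) (+ suc s) X<N+K _ _ eq =
  ⊥-elim (ℕP.<⇒≱ X<N+K (≤-by (s ℕ.* N ℕ.+ k) (trans (reorder N K s k) (sym eq))))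
  where
  reorder : ∀ N K s k → N ℕ.+ K ℕ.+ (s ℕ.* N ℕ.+ k) ≡ suc s ℕ.* N ℕ.+ k ℕ.+ K
  reorder = ℕSolver.solve-∀
decrease {K = K} {N} -[1+ k ] (+ suc s) X<N+K K<N _ eq = s≤s (ℕP.+-mono-≤ (s≤s s≤k) (s≤s s≤k))
  where
  instance _ : ℕ.NonZero N
  _ = nonZero K<N
  reorder : ∀ N K s → s ℕ.* N ℕ.+ (N ℕ.+ K) ≡ suc s ℕ.* N ℕ.+ 0 ℕ.+ K
  reorder = ℕSolver.solve-∀
  sN<1+k : s ℕ.* N < suc k
  sN<1+k = ℕP.+-cancelʳ-< (N ℕ.+ K) (s ℕ.* N) (suc k)
    (subst (_< suc k ℕ.+ (N ℕ.+ K)) (trans eq (sym (reorder N K s))) (ℕP.+-monoʳ-< (suc k) X<N+K))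
  s≤k : s ≤ k
  s≤k = ℕP.≤-trans (ℕP.m≤m*n s N) (ℕP.≤-pred sN<1+k)
decrease {X} {K} {N} (+ k) -[1+ s ] _ K<N _ eq =
  subst (_≤ k ℕ.+ k) (cong suc (ℕP.+-suc (suc s) (suc s))) (ℕP.+-mono-≤ 2+s≤k 2+s≤k)
  where
  instance _ : ℕ.NonZero N
  _ = nonZero K<N
  reorder₁ : ∀ s K → suc (suc s) ℕ.+ K ≡ s ℕ.+ suc (suc K)
  reorder₁ = ℕSolver.solve-∀
  reorder₂ : ∀ N s X → s ℕ.* N ℕ.+ N ℕ.+ X ≡ suc s ℕ.* N ℕ.+ 0 ℕ.+ X
  reorder₂ = ℕSolver.solve-∀
  2+s≤k : suc (suc s) ≤ k
  2+s≤k = ℕP.+-cancelʳ-≤ K (suc (suc s)) k (begin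
    suc (suc s) ℕ.+ K      ≡⟨ reorder₁ s K ⟩
    s ℕ.+ suc (suc K)      ≤⟨ ℕP.+-mono-≤ (ℕP.m≤m*n s N) K<N ⟩
    s ℕ.* N ℕ.+ N          ≤⟨ ℕP.m≤m+n _ X ⟩
    s ℕ.* N ℕ.+ N ℕ.+ X    ≡⟨ trans (reorder₂ N s X) eq ⟩
    k ℕ.+ K                ∎)
    where open ℕP.≤-Reasoning
decrease {X} {K} {N} -[1+ k ] -[1+ s ] _ K<N _ eq =
  ⊥-elim (ℕP.<⇒≱ (ℕP.<-trans (ℕP.n<1+n K) K<N) (≤-by (s ℕ.* N ℕ.+ suc k ℕ.+ X) (trans (reorder N s k X) eq)))
  where
  reorder : ∀ N s k X → N ℕ.+ (s ℕ.* N ℕ.+ suc k ℕ.+ X) ≡ suc s ℕ.* N ℕ.+ suc k ℕ.+ X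
  reorder = ℕSolver.solve-∀

peel-decreases : ∀ {X K N} (n t : ℤ) → X < N ℕ.+ K → suc K < N → n ≢ 0ℤ →
                 + X - + K ≡ n + + N * t → size t < size n
peel-decreases {X} {K} {N} n t X<N+K K<N n≢0 eq = decrease n t X<N+K K<N n≢0
  (equation-in-ℕ X K N (pos n) (neg n) (pos t) (neg t)
    (subst₂ (λ a b → + X - + K ≡ a + + N * b) (pos-neg n) (pos-neg t) eq))

∣⊖∣< : ∀ {u} a b → a < u → b < u → ℤ.∣ a ⊖ b ∣ < u
∣⊖∣< a b a<u b<u with ℕP.≤-total a b
... | inj₁ a≤b = subst (_< _) (sym (ℤP.∣⊖∣-≤ a≤b)) (ℕP.≤-<-trans (ℕP.m∸n≤m b a) b<u)
... | inj₂ b≤a = subst (_< _) (trans (sym (ℤP.∣⊖∣-≤ b≤a)) (ℤP.∣m⊖n∣≡∣n⊖m∣ b a))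
                   (ℕP.≤-<-trans (ℕP.m∸n≤m a b) a<u)

multiple-below : ∀ {u d} → u ℕD.∣ d → d < u → d ≡ 0
multiple-below {d = zero}  _   _   = refl
multiple-below {d = suc _} u∣d d<u = ⊥-elim (ℕD.>⇒∤ d<u u∣d)

fin-congruent : ∀ {u} (x x′ : Fin u) → + u ∣ + toℕ x - + toℕ x′ → x ≡ x′
fin-congruent {u} x x′ u∣ =
  FinP.toℕ-injective (ℤP.+-injective (ℤP.i-j≡0⇒i≡j _ _ (ℤP.∣i∣≡0⇒i≡0 (multiple-below (ℤD.∣⇒∣ᵤ u∣) gap<u))))
  where
  gap<u : ℤ.∣ + toℕ x - + toℕ x′ ∣ < u
  gap<u = subst (_< u) (cong ℤ.∣_∣ (sym (ℤP.m-n≡m⊖n (toℕ x) (toℕ x′))))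
                (∣⊖∣< (toℕ x) (toℕ x′) (FinP.toℕ<n x) (FinP.toℕ<n x′))

-- For coprime u₁, u₂ the numbers u₁x + u₂y with x, y ∈ Fin u₂ are pairwise incongruent
-- modulo u₂²: u₂ | u₁(x − x′) forces x = x′, and then u₂² | u₂(y − y′) forces y = y′.
combined-incongruent : ∀ {u₁ u₂} → Coprime u₁ u₂ → (x y x′ y′ : Fin u₂) →
  + (u₂ ℕ.* u₂) ∣ Φ (+ u₁) (+ u₂) (+ toℕ x - + toℕ x′) (+ toℕ y - + toℕ y′) → x ≡ x′ × y ≡ y′
combined-incongruent {u₁} {u₂@(suc _)} coprime x y x′ y′ N∣ = x≡x′ , y≡y′
  where
  δ ε : ℤ
  δ = + toℕ x - + toℕ x′
  ε = + toℕ y - + toℕ y′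
  square : + (u₂ ℕ.* u₂) ≡ + u₂ * + u₂
  square = ℤP.pos-* u₂ u₂
  u₂∣u₁δ : + u₂ ∣ + u₁ * δ
  u₂∣u₁δ = ℤD.∣m+n∣n⇒∣m (ℤD.∣-trans (divides (+ u₂) square) N∣) (ℤD.∣m⇒∣m*n ε ℤD.∣-refl)
  x≡x′ : x ≡ x′
  x≡x′ = fin-congruent x x′ (ℤD.∣ᵤ⇒∣ (Coprimality.coprime-divisor (Coprimality.sym coprime)
           (subst (u₂ ℕD.∣_) (ℤP.abs-* (+ u₁) δ) (ℤD.∣⇒∣ᵤ u₂∣u₁δ))))
  only-y : Φ (+ u₁) (+ u₂) δ ε ≡ + u₂ * ε
  only-y = subst (λ z → Φ (+ u₁) (+ u₂) (+ toℕ x - + toℕ z) ε ≡ + u₂ * ε) x≡x′ (drop (+ u₁) (+ toℕ x) (+ u₂ * ε))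
    where
    drop : ∀ a x z → a * (x - x) + z ≡ z
    drop = solve-∀
  y≡y′ : y ≡ y′
  y≡y′ = fin-congruent y y′ (ℤD.*-cancelˡ-∣ (+ u₂) (subst₂ _∣_ square only-y N∣))

≡-mod⇒∣ : ∀ a b N .{{_ : ℕ.NonZero N}} → a ℕ.% N ≡ b ℕ.% N → + N ∣ + a - + b
≡-mod⇒∣ a b N same = divides (+ (a ℕ./ N) - + (b ℕ./ N)) (begin
  + a - + b                                                   ≡⟨ cong₂ _-_ (split a) (split b) ⟩
  (+ (a ℕ.% N) + + (a ℕ./ N) * + N) - (+ (b ℕ.% N) + + (b ℕ./ N) * + N)
    ≡⟨ cong (λ r → (+ r + + (a ℕ./ N) * + N) - (+ (b ℕ.% N) + + (b ℕ./ N) * + N)) same ⟩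
  (+ (b ℕ.% N) + + (a ℕ./ N) * + N) - (+ (b ℕ.% N) + + (b ℕ./ N) * + N)
    ≡⟨ difference (+ (b ℕ.% N)) (+ (a ℕ./ N)) (+ (b ℕ./ N)) (+ N) ⟩
  (+ (a ℕ./ N) - + (b ℕ./ N)) * + N                            ∎)
  where
  open ≡-Reasoning
  split : ∀ c → + c ≡ + (c ℕ.% N) + + (c ℕ./ N) * + N
  split c = trans (cong +_ (ℕDM.m≡m%n+[m/n]*n c N))
    (trans (ℤP.pos-+ (c ℕ.% N) (c ℕ./ N ℕ.* N)) (cong (λ z → + (c ℕ.% N) + z) (ℤP.pos-* (c ℕ./ N) N)))
  difference : ∀ r p q n → (r + p * n) - (r + q * n) ≡ (p - q) * n
  difference = solve-∀

halve : ∀ w → ∃ λ m → w ≡ m ℕ.+ m ⊎ w ≡ suc (m ℕ.+ m)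
halve zero          = 0 , inj₁ refl
halve (suc zero)    = 0 , inj₂ refl
halve (suc (suc w)) with halve w
... | m , inj₁ refl = suc m , inj₁ (cong suc (sym (ℕP.+-suc m m)))
... | m , inj₂ refl = suc m , inj₂ (cong (suc ∘ suc) (sym (ℕP.+-suc m m)))

half≤ : ∀ {w m} → w ≡ m ℕ.+ m ⊎ w ≡ suc (m ℕ.+ m) → m ≤ w
half≤ {m = m} (inj₁ refl) = ℕP.m≤m+n m m
half≤ {m = m} (inj₂ refl) = ℕP.m≤n⇒m≤1+n (ℕP.m≤m+n m m)

-- For m = ⌊w/2⌋, w ≥ 1 and S ≤ 2w + 1:  S·w < (w+1)² + S·m  and  S·m + 1 < (w+1)².
-- With S = u₁ + u₂ these bound the combined digits: they lie in [−S·m, N − 1], S·m ≤ N − 2.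
digit-bounds : ∀ {S w m} → 1 ≤ w → w ≡ m ℕ.+ m ⊎ w ≡ suc (m ℕ.+ m) → S ≤ w ℕ.+ suc w →
               S ℕ.* w < suc w ℕ.* suc w ℕ.+ S ℕ.* m × suc (S ℕ.* m) < suc w ℕ.* suc w
digit-bounds {m = zero} () (inj₁ refl) _
digit-bounds {S} {m = m@(suc j)} _ (inj₁ refl) S≤ = Sw<N+Sm , Sm+1<N
  where
  open ℕP.≤-Reasoning
  N : ℕ
  N = suc (m ℕ.+ m) ℕ.* suc (m ℕ.+ m)
  polynomial : ∀ j → suc (suc ((suc j ℕ.+ suc j ℕ.+ suc (suc j ℕ.+ suc j)) ℕ.* suc j)) ℕ.+ (j ℕ.+ j ℕ.+ j ℕ.+ 2)
                     ≡ suc (suc j ℕ.+ suc j) ℕ.* suc (suc j ℕ.+ suc j)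
  polynomial = ℕSolver.solve-∀
  Sm+1<N : suc (S ℕ.* m) < N
  Sm+1<N = begin
    suc (suc (S ℕ.* m))                               ≤⟨ s≤s (s≤s (ℕP.*-monoˡ-≤ m S≤)) ⟩
    suc (suc ((m ℕ.+ m ℕ.+ suc (m ℕ.+ m)) ℕ.* m))     ≤⟨ ≤-by (j ℕ.+ j ℕ.+ j ℕ.+ 2) (polynomial j) ⟩
    suc (m ℕ.+ m) ℕ.* suc (m ℕ.+ m)                   ∎
  Sw<N+Sm : S ℕ.* (m ℕ.+ m) < N ℕ.+ S ℕ.* m
  Sw<N+Sm = subst (_< N ℕ.+ S ℕ.* m) (sym (ℕP.*-distribˡ-+ S m m))
                  (ℕP.+-monoˡ-< (S ℕ.* m) (ℕP.<-trans (ℕP.n<1+n _) Sm+1<N))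
digit-bounds {S} {m = m} _ (inj₂ refl) S≤ = Sw<N+Sm , Sm+1<N
  where
  open ℕP.≤-Reasoning
  N : ℕ
  N = suc (suc (m ℕ.+ m)) ℕ.* suc (suc (m ℕ.+ m))
  split : ∀ S m → S ℕ.* suc (m ℕ.+ m) ≡ S ℕ.* suc m ℕ.+ S ℕ.* m
  split = ℕSolver.solve-∀
  polynomial₁ : ∀ m → suc ((suc (m ℕ.+ m) ℕ.+ suc (suc (m ℕ.+ m))) ℕ.* suc m) ℕ.+ m
                      ≡ suc (suc (m ℕ.+ m)) ℕ.* suc (suc (m ℕ.+ m))
  polynomial₁ = ℕSolver.solve-∀
  polynomial₂ : ∀ m → suc (suc ((suc (m ℕ.+ m) ℕ.+ suc (suc (m ℕ.+ m))) ℕ.* m)) ℕ.+ (m ℕ.+ m ℕ.+ m ℕ.+ m ℕ.+ m ℕ.+ 2)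
                      ≡ suc (suc (m ℕ.+ m)) ℕ.* suc (suc (m ℕ.+ m))
  polynomial₂ = ℕSolver.solve-∀
  top<N : S ℕ.* suc m < N
  top<N = begin
    suc (S ℕ.* suc m)                                               ≤⟨ s≤s (ℕP.*-monoˡ-≤ (suc m) S≤) ⟩
    suc ((suc (m ℕ.+ m) ℕ.+ suc (suc (m ℕ.+ m))) ℕ.* suc m)         ≤⟨ ≤-by m (polynomial₁ m) ⟩
    suc (suc (m ℕ.+ m)) ℕ.* suc (suc (m ℕ.+ m))                     ∎
  Sm+1<N : suc (S ℕ.* m) < N
  Sm+1<N = begin
    suc (suc (S ℕ.* m))                                             ≤⟨ s≤s (s≤s (ℕP.*-monoˡ-≤ m S≤)) ⟩
    suc (suc ((suc (m ℕ.+ m) ℕ.+ suc (suc (m ℕ.+ m))) ℕ.* m))       ≤⟨ ≤-by (m ℕ.+ m ℕ.+ m ℕ.+ m ℕ.+ m ℕ.+ 2) (polynomial₂ m) ⟩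
    suc (suc (m ℕ.+ m)) ℕ.* suc (suc (m ℕ.+ m))                     ∎
  Sw<N+Sm : S ℕ.* suc (m ℕ.+ m) < N ℕ.+ S ℕ.* m
  Sw<N+Sm = subst (_< N ℕ.+ S ℕ.* m) (sym (split S m)) (ℕP.+-monoˡ-< (S ℕ.* m) top<N)

module Construction (u₁ w : ℕ) (1≤u₁ : 1 ≤ u₁) (u₁≤w : u₁ ≤ w) (coprime : Coprime u₁ (suc w)) where

  u₂ N : ℕ
  u₂ = suc w
  N  = u₂ ℕ.* u₂

  m : ℕ
  m = proj₁ (halve w)

  m-halves-w : w ≡ m ℕ.+ m ⊎ w ≡ suc (m ℕ.+ m)
  m-halves-w = proj₂ (halve w)

  Digit : Set
  Digit = Fin u₂

  ⟦_⟧ : Digit → ℤ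
  ⟦ d ⟧ = + toℕ d - + m

  m<u₂ : m < u₂
  m<u₂ = s≤s (half≤ {w} {m} m-halves-w)

  zeroDigit : Digit
  zeroDigit = fromℕ< m<u₂

  ⟦zeroDigit⟧ : ⟦ zeroDigit ⟧ ≡ 0ℤ
  ⟦zeroDigit⟧ = trans (cong (λ k → + k - + m) (FinP.toℕ-fromℕ< m<u₂)) (ℤP.+-inverseʳ (+ m))

  base : ℤ
  base = - + N

  eval : List Digit → ℤ
  eval []       = 0ℤ
  eval (d ∷ ds) = ⟦ d ⟧ + base * eval ds

  Expansions : SetOfIntegers
  Expansions a = Σ (List Digit) λ ds → eval ds ≡ a

  -- The combined digit u₁⟦d⟧ + u₂⟦e⟧ is X d e − K with X d e, K natural.
  X : Digit → Digit → ℕ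
  X d e = u₁ ℕ.* toℕ d ℕ.+ u₂ ℕ.* toℕ e

  K : ℕ
  K = (u₁ ℕ.+ u₂) ℕ.* m

  X-as-Φ : ∀ d e → + X d e ≡ Φ (+ u₁) (+ u₂) (+ toℕ d) (+ toℕ e)
  X-as-Φ d e = trans (ℤP.pos-+ (u₁ ℕ.* toℕ d) (u₂ ℕ.* toℕ e))
                     (cong₂ _+_ (ℤP.pos-* u₁ (toℕ d)) (ℤP.pos-* u₂ (toℕ e)))

  combined : ∀ d e → Φ (+ u₁) (+ u₂) ⟦ d ⟧ ⟦ e ⟧ ≡ + X d e - + K
  combined d e = begin
    Φ (+ u₁) (+ u₂) ⟦ d ⟧ ⟦ e ⟧                               ≡⟨ shift (+ u₁) (+ u₂) (+ toℕ d) (+ toℕ e) (+ m) ⟩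
    Φ (+ u₁) (+ u₂) (+ toℕ d) (+ toℕ e) - (+ u₁ + + u₂) * + m  ≡⟨ cong₂ _-_ (X-as-Φ d e) K-as-ℤ ⟨
    + X d e - + K                                             ∎
    where
    open ≡-Reasoning
    shift : ∀ a b x y k → a * (x - k) + b * (y - k) ≡ (a * x + b * y) - (a + b) * k
    shift = solve-∀
    K-as-ℤ : + K ≡ (+ u₁ + + u₂) * + m
    K-as-ℤ = trans (ℤP.pos-* (u₁ ℕ.+ u₂) m) (cong (_* + m) (ℤP.pos-+ u₁ u₂))

  bounds : (u₁ ℕ.+ u₂) ℕ.* w < N ℕ.+ K × suc K < N
  bounds = digit-bounds (ℕP.≤-trans 1≤u₁ u₁≤w) m-halves-w (ℕP.+-monoˡ-≤ u₂ u₁≤w)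

  X<N+K : ∀ d e → X d e < N ℕ.+ K
  X<N+K d e = ℕP.≤-<-trans X≤ (proj₁ bounds)
    where
    X≤ : X d e ≤ (u₁ ℕ.+ u₂) ℕ.* w
    X≤ = subst (X d e ≤_) (sym (ℕP.*-distribʳ-+ w u₁ u₂))
           (ℕP.+-mono-≤ (ℕP.*-monoʳ-≤ u₁ (ℕP.≤-pred (FinP.toℕ<n d))) (ℕP.*-monoʳ-≤ u₂ (ℕP.≤-pred (FinP.toℕ<n e))))

  K+1<N : suc K < N
  K+1<N = proj₂ bounds

  -- Fact (i): distinct digit pairs give combined digits incongruent modulo N ...
  incongruent : ∀ d e d′ e′ → + N ∣ + X d e - + X d′ e′ → d ≡ d′ × e ≡ e′
  incongruent d e d′ e′ N∣ = combined-incongruent coprime d e d′ e′ (subst (+ N ∣_) difference N∣)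
    where
    regroup : ∀ a b x y x′ y′ → (a * x + b * y) - (a * x′ + b * y′) ≡ a * (x - x′) + b * (y - y′)
    regroup = solve-∀
    difference : + X d e - + X d′ e′ ≡ Φ (+ u₁) (+ u₂) (+ toℕ d - + toℕ d′) (+ toℕ e - + toℕ e′)
    difference = trans (cong₂ _-_ (X-as-Φ d e) (X-as-Φ d′ e′)) (regroup (+ u₁) (+ u₂) _ _ _ _)

  residue : Digit × Digit → Fin N
  residue (d , e) = fromℕ< (ℕDM.m%n<n (X d e) N)

  toℕ-residue : ∀ d e → toℕ (residue (d , e)) ≡ X d e ℕ.% N
  toℕ-residue d e = FinP.toℕ-fromℕ< (ℕDM.m%n<n (X d e) N)

  residue-injective : ∀ de de′ → residue de ≡ residue de′ → de ≡ de′
  residue-injective (d , e) (d′ , e′) same =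
    uncurry (cong₂ _,_) (incongruent d e d′ e′ (≡-mod⇒∣ (X d e) (X d′ e′) N same-remainder))
    where
    same-remainder : X d e ℕ.% N ≡ X d′ e′ ℕ.% N
    same-remainder = trans (sym (toℕ-residue d e)) (trans (cong toℕ same) (toℕ-residue d′ e′))

  -- ... hence, since Digit × Digit ≅ Fin N, they meet every residue class.
  residue-surjective : ∀ r → ∃ λ de → residue de ≡ r
  residue-surjective r =
    let (i , hit) = injective⇒surjective (residue ∘ pair) pair-injective r
    in pair i , hit
    where
    pair : Fin N → Digit × Digit
    pair = Fin.remQuot {u₂} u₂
    pair-injective : ∀ i j → residue (pair i) ≡ residue (pair j) → i ≡ j
    pair-injective i j same = begin
      i                                       ≡⟨ FinP.combine-remQuot {u₂} u₂ i ⟨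
      uncurry (Fin.combine {u₂} {u₂}) (pair i) ≡⟨ cong (uncurry Fin.combine) (residue-injective _ _ same) ⟩
      uncurry (Fin.combine {u₂} {u₂}) (pair j) ≡⟨ FinP.combine-remQuot {u₂} u₂ j ⟩
      j                                       ∎
      where open ≡-Reasoning

  congruent⇒peel : ∀ n d e → X d e ℕ.% N ≡ (n + + K) %ℕ N →
                   + X d e - + K ≡ n + + N * (+ (X d e ℕ./ N) - (n + + K) /ℕ N)
  congruent⇒peel n d e same-remainder = begin
    + X d e - + K                             ≡⟨ cong (_- + K) split-X ⟩
    (+ r + + p * + N) - + K                   ≡⟨ regroup (+ r) (+ p) q (+ K) (+ N) ⟩
    ((+ r + q * + N) - + K) + + N * (+ p - q)  ≡⟨ cong (λ a → (a - + K) + + N * (+ p - q)) (a≡a%ℕn+[a/ℕn]*n (n + + K) N) ⟨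
    ((n + + K) - + K) + + N * (+ p - q)       ≡⟨ unshift n (+ K) (+ N * (+ p - q)) ⟩
    n + + N * (+ p - q)                       ∎
    where
    open ≡-Reasoning
    r p : ℕ
    r = (n + + K) %ℕ N
    p = X d e ℕ./ N
    q : ℤ
    q = (n + + K) /ℕ N
    split-X : + X d e ≡ + r + + p * + N
    split-X = begin
      + X d e                              ≡⟨ cong +_ (ℕDM.m≡m%n+[m/n]*n (X d e) N) ⟩
      + (X d e ℕ.% N ℕ.+ p ℕ.* N)          ≡⟨ ℤP.pos-+ (X d e ℕ.% N) (p ℕ.* N) ⟩
      + (X d e ℕ.% N) + + (p ℕ.* N)        ≡⟨ cong₂ (λ a b → + a + b) same-remainder (ℤP.pos-* p N) ⟩
      + r + + p * + N                      ∎
    regroup : ∀ r p q k n → (r + p * n) - k ≡ ((r + q * n) - k) + n * (p - q)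
    regroup = solve-∀
    unshift : ∀ a k b → ((a + k) - k) + b ≡ a + b
    unshift = solve-∀

  peel : ∀ n → ∃₂ λ d e → ∃ λ t → + X d e - + K ≡ n + + N * t
  peel n =
    let ((d , e) , hit) = residue-surjective (fromℕ< (n%ℕd<d (n + + K) N))
    in d , e , _ , congruent⇒peel n d e (trans (sym (toℕ-residue d e))
                                          (trans (cong toℕ hit) (FinP.toℕ-fromℕ< (n%ℕd<d (n + + K) N))))

  lowest : ∀ d e a b → Φ (+ u₁) (+ u₂) (⟦ d ⟧ + base * a) (⟦ e ⟧ + base * b) ≡
                       (+ X d e - + K) + base * Φ (+ u₁) (+ u₂) a b
  lowest d e a b = trans (Φ-linear (+ u₁) (+ u₂) ⟦ d ⟧ ⟦ e ⟧ a b base)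
                         (cong (_+ base * Φ (+ u₁) (+ u₂) a b) (combined d e))

  extend : ∀ {n t} d e xs ys → + X d e - + K ≡ n + + N * t →
           Φ (+ u₁) (+ u₂) (eval xs) (eval ys) ≡ t → Φ (+ u₁) (+ u₂) (eval (d ∷ xs)) (eval (e ∷ ys)) ≡ n
  extend {n} {t} d e xs ys digit rep = begin
    Φ (+ u₁) (+ u₂) (eval (d ∷ xs)) (eval (e ∷ ys))                  ≡⟨ lowest d e (eval xs) (eval ys) ⟩
    (+ X d e - + K) + base * Φ (+ u₁) (+ u₂) (eval xs) (eval ys)    ≡⟨ cong₂ (λ c a → c + base * a) digit rep ⟩
    (n + + N * t) + - + N * t                                       ≡⟨ cancel n (+ N) t ⟩
    n                                                               ∎
    where
    open ≡-Reasoning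
    cancel : ∀ n k t → (n + k * t) + - k * t ≡ n
    cancel = solve-∀

  represent : ∀ n → ∃₂ λ xs ys → Φ (+ u₁) (+ u₂) (eval xs) (eval ys) ≡ n
  represent n = go n (On.wellFounded size <-wellFounded n)
    where
    go : ∀ n → Acc (_<_ on size) n → ∃₂ λ xs ys → Φ (+ u₁) (+ u₂) (eval xs) (eval ys) ≡ n
    go n (acc smaller) with n ℤ.≟ 0ℤ
    ... | yes refl = [] , [] , cong₂ _+_ (ℤP.*-zeroʳ (+ u₁)) (ℤP.*-zeroʳ (+ u₂))
    ... | no n≢0 =
      let (d , e , t , digit) = peel n
          (xs , ys , rep) = go t (smaller (peel-decreases n t (X<N+K d e) K+1<N n≢0 digit))
      in d ∷ xs , e ∷ ys , extend d e xs ys digit rep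

  -- Lowest digit and remainder of an expansion; beyond its end it continues with zeroDigit.
  head : List Digit → Digit
  head []      = zeroDigit
  head (d ∷ _) = d

  tail : List Digit → List Digit
  tail []       = []
  tail (_ ∷ ds) = ds

  eval-view : ∀ ds → eval ds ≡ ⟦ head ds ⟧ + base * eval (tail ds)
  eval-view []      = sym (cong₂ _+_ ⟦zeroDigit⟧ (ℤP.*-zeroʳ base))
  eval-view (_ ∷ _) = refl

  tail-shorter : ∀ {k} ds → length ds ≤ suc k → length (tail ds) ≤ k
  tail-shorter []      _         = z≤n
  tail-shorter (_ ∷ _) (s≤s len) = len

  agree : ∀ ds ds′ → head ds ≡ head ds′ → eval (tail ds) ≡ eval (tail ds′) → eval ds ≡ eval ds′
  agree ds ds′ same-head same-tail = begin
    eval ds                                 ≡⟨ eval-view ds ⟩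
    ⟦ head ds ⟧ + base * eval (tail ds)     ≡⟨ cong₂ (λ d a → ⟦ d ⟧ + base * a) same-head same-tail ⟩
    ⟦ head ds′ ⟧ + base * eval (tail ds′)   ≡⟨ eval-view ds′ ⟨
    eval ds′                                ∎
    where open ≡-Reasoning

  lowest-congruent : ∀ d e d′ e′ a a′ → (+ X d e - + K) + base * a ≡ (+ X d′ e′ - + K) + base * a′ →
                     + N ∣ + X d e - + X d′ e′
  lowest-congruent d e d′ e′ a a′ eq = divides (a - a′) (begin
    + X d e - + X d′ e′                                                                   ≡⟨ rearrange (+ X d e) (+ X d′ e′) (+ K) a a′ (+ N) ⟩
    (((+ X d e - + K) + base * a) - ((+ X d′ e′ - + K) + base * a′)) + (a - a′) * + N   ≡⟨ cong (λ z → (z - ((+ X d′ e′ - + K) + base * a′)) + (a - a′) * + N) eq ⟩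
    (((+ X d′ e′ - + K) + base * a′) - ((+ X d′ e′ - + K) + base * a′)) + (a - a′) * + N ≡⟨ vanish ((+ X d′ e′ - + K) + base * a′) ((a - a′) * + N) ⟩
    (a - a′) * + N                                                                        ∎)
    where
    open ≡-Reasoning
    rearrange : ∀ x x′ k a a′ n → x - x′ ≡ (((x - k) + - n * a) - ((x′ - k) + - n * a′)) + (a - a′) * n
    rearrange = solve-∀
    vanish : ∀ c z → (c - c) + z ≡ z
    vanish = solve-∀

  lowest-digits : ∀ d e d′ e′ a a′ → (+ X d e - + K) + base * a ≡ (+ X d′ e′ - + K) + base * a′ →
                  (d ≡ d′ × e ≡ e′) × a ≡ a′
  lowest-digits d e d′ e′ a a′ eq =
    let (d≡d′ , e≡e′) = incongruent d e d′ e′ (lowest-congruent d e d′ e′ a a′ eq)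
    in (d≡d′ , e≡e′) ,
       ℤP.*-cancelˡ-≡ base a a′ (+-cancelˡ (+ X d′ e′ - + K) _ _
         (subst₂ (λ x y → (+ X x y - + K) + base * a ≡ (+ X d′ e′ - + K) + base * a′) d≡d′ e≡e′ eq))

  split-lowest : ∀ xs ys → Φ (+ u₁) (+ u₂) (eval xs) (eval ys) ≡
                 (+ X (head xs) (head ys) - + K) + base * Φ (+ u₁) (+ u₂) (eval (tail xs)) (eval (tail ys))
  split-lowest xs ys = trans (cong₂ (Φ (+ u₁) (+ u₂)) (eval-view xs) (eval-view ys))
                             (lowest (head xs) (head ys) (eval (tail xs)) (eval (tail ys)))

  unique-up-to : ∀ k xs ys xs′ ys′ → length xs ≤ k → length ys ≤ k → length xs′ ≤ k → length ys′ ≤ k →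
                 Φ (+ u₁) (+ u₂) (eval xs) (eval ys) ≡ Φ (+ u₁) (+ u₂) (eval xs′) (eval ys′) →
                 eval xs ≡ eval xs′ × eval ys ≡ eval ys′
  unique-up-to zero [] [] [] [] _ _ _ _ _ = refl , refl
  unique-up-to zero (_ ∷ _) _ _ _ () _ _ _ _
  unique-up-to zero [] (_ ∷ _) _ _ _ () _ _ _
  unique-up-to zero [] [] (_ ∷ _) _ _ _ () _ _
  unique-up-to zero [] [] [] (_ ∷ _) _ _ _ () _
  unique-up-to (suc k) xs ys xs′ ys′ lx ly lx′ ly′ eq =
    let ((same-x , same-y) , same-rest) =
          lowest-digits _ _ _ _ _ _ (trans (sym (split-lowest xs ys)) (trans eq (split-lowest xs′ ys′)))
        (rest-x , rest-y) = unique-up-to k (tail xs) (tail ys) (tail xs′) (tail ys′)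
          (tail-shorter xs lx) (tail-shorter ys ly) (tail-shorter xs′ lx′) (tail-shorter ys′ ly′) same-rest
    in agree xs xs′ same-x rest-x , agree ys ys′ same-y rest-y

  unique : ∀ xs ys xs′ ys′ → Φ (+ u₁) (+ u₂) (eval xs) (eval ys) ≡ Φ (+ u₁) (+ u₂) (eval xs′) (eval ys′) →
           eval xs ≡ eval xs′ × eval ys ≡ eval ys′
  unique xs ys xs′ ys′ = unique-up-to ((lx ℕ.+ ly) ℕ.+ (lx′ ℕ.+ ly′)) xs ys xs′ ys′
    (ℕP.≤-trans (ℕP.m≤m+n lx ly) first) (ℕP.≤-trans (ℕP.m≤n+m ly lx) first)
    (ℕP.≤-trans (ℕP.m≤m+n lx′ ly′) second) (ℕP.≤-trans (ℕP.m≤n+m ly′ lx′) second)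
    where
    lx ly lx′ ly′ : ℕ
    lx = length xs
    ly = length ys
    lx′ = length xs′
    ly′ = length ys′
    first : lx ℕ.+ ly ≤ (lx ℕ.+ ly) ℕ.+ (lx′ ℕ.+ ly′)
    first = ℕP.m≤m+n (lx ℕ.+ ly) (lx′ ℕ.+ ly′)
    second : lx′ ℕ.+ ly′ ≤ (lx ℕ.+ ly) ℕ.+ (lx′ ℕ.+ ly′)
    second = ℕP.m≤n+m (lx′ ℕ.+ ly′) (lx ℕ.+ ly)

  unique-representation : UniqueRepresentationBasis Expansions (+ u₁) (+ u₂)
  unique-representation n =
    let (xs , ys , rep) = represent n
    in (eval xs , eval ys) , (xs , refl) , (ys , refl) , rep ,
       λ { _ _ (xs′ , refl) (ys′ , refl) rep′ → uncurry (cong₂ _,_) (unique xs′ ys′ xs ys (trans rep′ (sym rep))) }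

mainTheorem3 : (u₁ u₂ : ℕ) → 1 ≤ u₁ → u₁ < u₂ → Coprime u₁ u₂ →
    Σ SetOfIntegers (λ A → UniqueRepresentationBasis A (+ u₁) (+ u₂))
mainTheorem3 u₁ (suc w) 1≤u₁ (s≤s u₁≤w) coprime = Expansions , unique-representation
  where open Construction u₁ w 1≤u₁ u₁≤w coprime
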